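{- Let $\Sigma$ be a finite alphabet with at least two symbols. There is no algorithm with oracle access which, for every almost periodic sequence $\omega\in\Sigma^{\mathbb{N}}$ and every almost periodicity regulator $f$ of $\omega$, given oracle access to $\omega$ and $f$, halts and correctly decides whether $\omega$ is eventually strongly almost periodic.
   Context: For a sequence $\omega$, write $\omega[i,j]=\omega(i)\dots\omega(j)$ and $\omega[i,\infty)$ for the suffix starting at $i$; a factor is a nonempty string $\omega[i,j]$. A sequence is almost periodic if for every factor $x$ occurring in it infinitely many times there is $l$ such that every factor of length $l$ contains an occurrence of $x$. It is strongly almost periodic if this holds for every factor $x$; it is eventually strongly almost periodic if some suffix is strongly almost periodic. A function $r\colon\mathbb{N}\to\mathbb{N}$ is an almost periodicity regulator of an almost periodic $\omega$ if (1) every string of length $k$ occurring in $\omega$ infinitely many times occurs in every factor of $\omega$ of length $r(k)$, and (2) every string of length $k$ occurring in $\omega$ only finitely many times does not occur in $\omega[r(k),\infty)$. An algorithm with oracle access to $\omega$ and $f$ may query values $\omega(i)$ and $f(i)$. -}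

module Defs where

open import Data.Nat using (ℕ; zero; suc; _+_; _≤_; _<_)
open import Data.Fin using (Fin; toℕ)
open import Data.List using (List; []; _∷_; length; lookup)
open import Data.Bool using (Bool; true)
open import Data.Maybe using (Maybe; just; nothing)
open import Data.Sum using (_⊎_; inj₁; inj₂)
open import Data.Product using (Σ; ∃; _×_; _,_)
open import Relation.Nullary using (¬_)
open import Relation.Binary.PropositionalEquality using (_≡_)
open import Function.Bundles using (_⇔_)

Seq : ℕ → Set
Seq k = ℕ → Fin k

Str : ℕ → Set
Str k = List (Fin k)

OccursAt : ∀ {k} → Seq k → Str k → ℕ → Set
OccursAt ω x i = (j : Fin (length x)) → ω (i + toℕ j) ≡ lookup x j

Occurs : ∀ {k} → Seq k → Str k → Set
Occurs ω x = ∃ λ i → OccursAt ω x i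

InfOften : ∀ {k} → Seq k → Str k → Set
InfOften ω x = (N : ℕ) → ∃ λ i → N ≤ i × OccursAt ω x i

ContainsIn : ∀ {k} → Seq k → ℕ → ℕ → Str k → Set
ContainsIn ω i l x = ∃ λ j → i ≤ j × (j + length x ≤ i + l) × OccursAt ω x j

EveryFactorContains : ∀ {k} → Seq k → ℕ → Str k → Set
EveryFactorContains ω l x = (i : ℕ) → ContainsIn ω i l x

AlmostPeriodic : ∀ {k} → Seq k → Set
AlmostPeriodic {k} ω =
  (x : Str k) → 1 ≤ length x → InfOften ω x → ∃ λ l → EveryFactorContains ω l x

StronglyAlmostPeriodic : ∀ {k} → Seq k → Set
StronglyAlmostPeriodic {k} ω =
  (x : Str k) → 1 ≤ length x → Occurs ω x → ∃ λ l → EveryFactorContains ω l x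

suffix : ∀ {k} → Seq k → ℕ → Seq k
suffix ω n i = ω (n + i)

EventuallyStronglyAlmostPeriodic : ∀ {k} → Seq k → Set
EventuallyStronglyAlmostPeriodic ω = ∃ λ n → StronglyAlmostPeriodic (suffix ω n)

-- r is an almost periodicity regulator of ω.
-- "occurs only finitely many times" is read as "does not occur infinitely many times".
IsRegulator : ∀ {k} → Seq k → (ℕ → ℕ) → Set
IsRegulator {k} ω r =
  ((m : ℕ) (x : Str k) → length x ≡ m → InfOften ω x → EveryFactorContains ω (r m) x)
  × ((m : ℕ) (x : Str k) → length x ≡ m → ¬ InfOften ω x →
       (i : ℕ) → r m ≤ i → ¬ OccursAt ω x i)

-- Oracle algorithms.
-- A query is either "ω(i)?" (inj₁ i) or "f(i)?" (inj₂ i); the answer is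
-- a symbol (inj₁ a) or a natural number (inj₂ v).
Query : Set
Query = ℕ ⊎ ℕ

Answer : ℕ → Set
Answer k = Fin k ⊎ ℕ

-- An oracle algorithm: given the list of answers received so far (most
-- recent first), either issues the next query (inj₁ q) or halts with an
-- output bit (inj₂ b).
OracleAlg : ℕ → Set
OracleAlg k = List (Answer k) → Query ⊎ Bool

answer : ∀ {k} → Seq k → (ℕ → ℕ) → Query → Answer k
answer ω f (inj₁ i) = inj₁ (ω i)
answer ω f (inj₂ i) = inj₂ (f i)

-- Run the algorithm for at most n+1 steps from history h.
run : ∀ {k} → OracleAlg k → Seq k → (ℕ → ℕ) → ℕ → List (Answer k) → Maybe Bool
run A ω f n h with A h
... | inj₂ b = just b
run A ω f zero h | inj₁ q = nothing
run A ω f (suc n) h | inj₁ q = run A ω f n (answer ω f q ∷ h)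

HaltsWith : ∀ {k} → OracleAlg k → Seq k → (ℕ → ℕ) → Bool → Set
HaltsWith A ω f b = ∃ λ n → run A ω f n [] ≡ just b

DecidesESAP : ∀ {k} → OracleAlg k → Seq k → (ℕ → ℕ) → Set
DecidesESAP A ω f =
  ∃ λ b → HaltsWith A ω f b × ((b ≡ true) ⇔ EventuallyStronglyAlmostPeriodic ω)

{-# OPTIONS --safe #-}
-- Let pd be the period-doubling sequence, pd n = parity of the 2-adic valuation of n + 1, and let
-- perturbed J be pd with the value 1 forced at every Mersenne number 2^j − 1 ≥ J. Shifting by 2^K
-- leaves pd unchanged on [0, 2^(K+1) − 1) except at 2^K − 1, where it toggles; a window [i, i + m)
-- with m ≤ i contains at most one Mersenne number, so every such late window of a perturbation is a
-- factor of pd, and a factor of pd of length m recurs in every window of length 2^(m+3). Hence pd and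
-- all perturbed J are almost periodic with the common regulator m ↦ 2^(m+3), and pd is strongly
-- almost periodic. But pd is rigid around M = 2^j − 1: any q with pd (q + r) = pd (M + r) for
-- 0 < r < 3·2^j has pd q = pd M. For j even perturbed J differs from pd at M only, so that factor of
-- perturbed J never recurs late, and perturbed J is not eventually strongly almost periodic.
-- An algorithm that halts on (pd, regulator) reads ω only up to some N, so it gives the same answer
-- on (perturbed (N + 1), regulator), although the correct answers differ.
module Submission where

open import Defs
open import Data.Bool as Bool using (Bool; true; false; not; _∨_)
open import Data.Bool.Properties using (not-involutive; not-injective; ¬-not; ∨-zeroʳ)
open import Data.Fin using (Fin; zero; suc; toℕ; fromℕ<)
open import Data.Fin.Properties using (toℕ<n; toℕ-fromℕ<)
open import Data.List using (List; []; _∷_; length; lookup)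
open import Data.Maybe using (just)
open import Data.Nat
open import Data.Nat.Binary as ℕᵇ using (ℕᵇ; 2[1+_]; 1+[2_])
open import Data.Nat.Binary.Properties as ℕᵇ using ()
open import Data.Nat.DivMod using (_%_; _/_; m%n<n; m≡m%n+[m/n]*n; m/n*n≤m)
open import Data.Nat.Divisibility using (_∣_; divides; ∣⇒≤; ∣m+n∣m⇒∣n; n∣m*n)
open import Data.Nat.Properties
open import Algebra.Properties.CommutativeSemigroup +-commutativeSemigroup using (xy∙z≈xz∙y)
open import Data.Nat.Tactic.RingSolver using (solve-∀)
open import Data.Product using (Σ; ∃; _,_; _×_; proj₂; map₁; map₂)
open import Data.Sum using (inj₁; inj₂)
open import Function using (_∘_)
open import Function.Bundles using (Equivalence)
open import Relation.Binary using (tri<; tri≈; tri>)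
open import Relation.Binary.PropositionalEquality
open import Relation.Nullary using (¬_; contradiction; yes; no; does)
open import Relation.Nullary.Decidable using (map′; _×-dec_; dec-true; dec-false)
open import Relation.Unary using (Decidable)

SameFactor : {A : Set} → (ℕ → A) → ℕ → (ℕ → A) → ℕ → ℕ → Set
SameFactor g i h j m = ∀ r → r < m → g (i + r) ≡ h (j + r)

occursAt-sameFactor : ∀ {k} {ω : Seq k} {x i j} →
                      OccursAt ω x i → OccursAt ω x j → SameFactor ω i ω j (length x)
occursAt-sameFactor {ω = ω} {x} {i} {j} occᵢ occⱼ r r<m = begin
  ω (i + r)                ≡⟨ cong (λ r → ω (i + r)) (toℕ-fromℕ< r<m) ⟨
  ω (i + toℕ (fromℕ< r<m)) ≡⟨ occᵢ _ ⟩
  lookup x (fromℕ< r<m)    ≡⟨ occⱼ _ ⟨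
  ω (j + toℕ (fromℕ< r<m)) ≡⟨ cong (λ r → ω (j + r)) (toℕ-fromℕ< r<m) ⟩
  ω (j + r)                ∎
  where open ≡-Reasoning

factor : ∀ {k} → Seq k → ℕ → ℕ → Str k
factor ω i zero    = []
factor ω i (suc m) = ω i ∷ factor ω (suc i) m

length-factor : ∀ {k} (ω : Seq k) i m → length (factor ω i m) ≡ m
length-factor ω i zero    = refl
length-factor ω i (suc m) = cong suc (length-factor ω (suc i) m)

factor-occursAt : ∀ {k} (ω : Seq k) i m → OccursAt ω (factor ω i m) i
factor-occursAt ω i (suc m) zero    = cong ω (+-identityʳ i)
factor-occursAt ω i (suc m) (suc r) = trans (cong ω (+-suc i (toℕ r))) (factor-occursAt ω (suc i) m r)

LateFactorsRecur : ∀ {k} → Seq k → (ℕ → ℕ) → Set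
LateFactorsRecur ω R =
  ∀ x i → R (length x) ≤ i → OccursAt ω x i → EveryFactorContains ω (R (length x)) x

lateFactorsRecur⇒isRegulator : ∀ {k} {ω : Seq k} {R} → LateFactorsRecur ω R → IsRegulator ω R
lateFactorsRecur⇒isRegulator {ω = ω} {R} recur = frequent , rare
  where
  frequent : ∀ m x → length x ≡ m → InfOften ω x → EveryFactorContains ω (R m) x
  frequent _ x refl inf with inf (R (length x))
  ... | i , R≤i , occ = recur x i R≤i occ
  rare : ∀ m x → length x ≡ m → ¬ InfOften ω x → ∀ i → R m ≤ i → ¬ OccursAt ω x i
  rare _ x refl fin i R≤i occ = fin λ N → let j , N≤j , _ , occⱼ = recur x i R≤i occ N in j , N≤j , occⱼ

isRegulator⇒almostPeriodic : ∀ {k} {ω : Seq k} {R} → IsRegulator ω R → AlmostPeriodic ω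
isRegulator⇒almostPeriodic {R = R} (frequent , _) x _ inf = R (length x) , frequent (length x) x refl inf

module _ {k : ℕ} (A : OracleAlg k) (f : ℕ → ℕ) where

  maxQuery : Seq k → ℕ → List (Answer k) → ℕ
  maxQuery ω n h with A h
  ... | inj₂ _ = 0
  maxQuery ω zero    h | inj₁ _        = 0
  maxQuery ω (suc n) h | inj₁ (inj₁ i) = i ⊔ maxQuery ω n (inj₁ (ω i) ∷ h)
  maxQuery ω (suc n) h | inj₁ (inj₂ i) = maxQuery ω n (inj₂ (f i) ∷ h)

  run-cong : ∀ ω ω′ n h → (∀ i → i ≤ maxQuery ω n h → ω′ i ≡ ω i) → run A ω′ f n h ≡ run A ω f n h
  run-cong ω ω′ n h agree with A h
  ... | inj₂ _ = refl
  run-cong ω ω′ zero    h agree | inj₁ _ = refl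
  run-cong ω ω′ (suc n) h agree | inj₁ (inj₁ i) rewrite agree i (m≤m⊔n i _) =
    run-cong ω ω′ n _ (λ i′ i′≤ → agree i′ (≤-trans i′≤ (m≤n⊔m i _)))
  run-cong ω ω′ (suc n) h agree | inj₁ (inj₂ i) = run-cong ω ω′ n _ agree

  run-functional : ∀ ω n n′ h {b b′} → run A ω f n h ≡ just b → run A ω f n′ h ≡ just b′ → b ≡ b′
  run-functional ω n n′ h halts halts′ with A h
  run-functional ω n       n′       h refl refl   | inj₂ _ = refl
  run-functional ω zero    n′       h ()   _      | inj₁ _
  run-functional ω (suc n) zero     h _    ()     | inj₁ _
  run-functional ω (suc n) (suc n′) h halts halts′ | inj₁ _ = run-functional ω n n′ _ halts halts′

  haltsWith-continuous : ∀ {ω b} → HaltsWith A ω f b →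
                         ∃ λ N → ∀ ω′ → (∀ i → i ≤ N → ω′ i ≡ ω i) → HaltsWith A ω′ f b
  haltsWith-continuous {ω} (n , halts) =
    maxQuery ω n [] , λ ω′ agree → n , trans (run-cong ω ω′ n [] agree) halts

  haltsWith-functional : ∀ {ω b b′} → HaltsWith A ω f b → HaltsWith A ω f b′ → b ≡ b′
  haltsWith-functional {ω} (n , halts) (n′ , halts′) = run-functional ω n n′ [] halts halts′

-- The period-doubling sequence

data EvenOdd : ℕ → Set where
  even : ∀ a → EvenOdd (2 * a)
  odd  : ∀ a → EvenOdd (suc (2 * a))

evenOdd : ∀ n → EvenOdd n
evenOdd zero = even 0
evenOdd (suc n) with evenOdd n
... | even a = odd a
... | odd a  = subst EvenOdd (*-suc 2 a) (even (suc a))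

n<2^n : ∀ n → n < 2 ^ n
n<2^n zero    = z<s
n<2^n (suc n) = +-mono-≤-< (m^n>0 2 n) (<-≤-trans (n<2^n n) (m≤m+n _ 0))

mersenne : ℕ → ℕ
mersenne zero    = 0
mersenne (suc j) = suc (2 * mersenne j)

IsMersenne : ℕ → Set
IsMersenne n = ∃ λ j → mersenne j ≡ n

suc-mersenne : ∀ j → suc (mersenne j) ≡ 2 ^ j
suc-mersenne zero    = refl
suc-mersenne (suc j) = trans (sym (*-suc 2 (mersenne j))) (cong (2 *_) (suc-mersenne j))

mersenne-+-2^ : ∀ j → mersenne j + 2 ^ j ≡ mersenne (suc j)
mersenne-+-2^ j = trans (cong (mersenne j +_) (sym (suc-mersenne j))) (m+suc-m (mersenne j))
  where
  m+suc-m : ∀ m → m + suc m ≡ suc (2 * m)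
  m+suc-m = solve-∀

j≤mersenne : ∀ j → j ≤ mersenne j
j≤mersenne zero    = z≤n
j≤mersenne (suc j) = s≤s (≤-trans (j≤mersenne j) (m≤m+n _ _))

mersenne-mono-≤ : ∀ {j j′} → j ≤ j′ → mersenne j ≤ mersenne j′
mersenne-mono-≤ z≤n        = z≤n
mersenne-mono-≤ (s≤s j≤j′) = s≤s (*-monoʳ-≤ 2 (mersenne-mono-≤ j≤j′))

mersenne-cancel-< : ∀ {j j′} → mersenne j < mersenne j′ → j < j′
mersenne-cancel-< Mj<Mj′ = ≰⇒> λ j′≤j → <⇒≱ Mj<Mj′ (mersenne-mono-≤ j′≤j)

mersenne-above : ∀ i → ∃ λ K → i ≤ mersenne K × (∀ j → j < K → mersenne j < i)
mersenne-above zero = 0 , z≤n , λ _ ()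
mersenne-above (suc i) with mersenne-above i
... | K , i≤M , below with m≤n⇒m<n∨m≡n i≤M
...   | inj₁ i<M  = K , i<M , λ j j<K → m<n⇒m<1+n (below j j<K)
...   | inj₂ refl = suc K , s≤s (m≤m+n _ _) , λ j j<K+1 → s≤s (mersenne-mono-≤ (≤-pred j<K+1))

isMersenne? : Decidable IsMersenne
isMersenne? n = map′ (λ (j , _ , Mj≡n) → j , Mj≡n)
                     (λ (j , Mj≡n) → j , s≤s (≤-trans (j≤mersenne j) (≤-reflexive Mj≡n)) , Mj≡n)
                     (anyUpTo? (λ j → mersenne j ≟ n) (suc n))

a+[1+s]*2^K-notMersenne : ∀ K a s → suc a < 2 ^ K → ¬ IsMersenne (a + suc s * 2 ^ K)
a+[1+s]*2^K-notMersenne K a s a<2^K (j , Mj≡) = <⇒≱ a<2^K (∣⇒≤ 2^K∣1+a)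
  where
  P = 2 ^ K
  2^j≡ : 2 ^ j ≡ suc s * P + suc a
  2^j≡ = trans (sym (suc-mersenne j)) (trans (cong suc (trans Mj≡ (+-comm a _))) (sym (+-suc _ a)))
  K≤j : K ≤ j
  K≤j = ≮⇒≥ λ j<K → <⇒≱ (^-monoʳ-< 2 (s≤s (s≤s z≤n)) j<K)
                          (≤-trans (m≤m+n P (s * P))
                                   (≤-trans (m≤m+n _ (suc a)) (≤-reflexive (sym 2^j≡))))
  2^K∣2^j : P ∣ 2 ^ j
  2^K∣2^j with m≤n⇒∃[o]m+o≡n K≤j
  ... | d , refl = divides (2 ^ d) (trans (^-distribˡ-+-* 2 K d) (*-comm P (2 ^ d)))
  2^K∣1+a : P ∣ suc a
  2^K∣1+a = ∣m+n∣m⇒∣n (subst (P ∣_) 2^j≡ 2^K∣2^j) (n∣m*n (suc s))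

pdᵇ : ℕᵇ → Bool
pdᵇ ℕᵇ.zero  = false
pdᵇ 2[1+ _ ] = false
pdᵇ 1+[2 x ] = not (pdᵇ x)

pd : ℕ → Bool
pd n = pdᵇ (ℕᵇ.fromℕ n)

fromℕ-odd : ∀ a → ℕᵇ.fromℕ (suc (2 * a)) ≡ 1+[2 ℕᵇ.fromℕ a ]
fromℕ-odd a = ℕᵇ.toℕ-injective (trans (ℕᵇ.toℕ-fromℕ _) (cong (λ b → suc (2 * b)) (sym (ℕᵇ.toℕ-fromℕ a))))

pd-even : ∀ a → pd (2 * a) ≡ false
pd-even a with ℕᵇ.fromℕ (2 * a) in eq
... | ℕᵇ.zero  = refl
... | 2[1+ _ ] = refl
... | 1+[2 x ] = contradiction (trans (sym (ℕᵇ.toℕ-fromℕ (2 * a))) (cong ℕᵇ.toℕ eq))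
                               (even≢odd a (ℕᵇ.toℕ x))

pd-odd : ∀ a → pd (suc (2 * a)) ≡ not (pd a)
pd-odd a = cong pdᵇ (fromℕ-odd a)

pd-even-+ : ∀ a r → pd (2 * a + 2 * r) ≡ false
pd-even-+ a r = trans (cong pd (sym (*-distribˡ-+ 2 a r))) (pd-even (a + r))

pd-odd-+ : ∀ a r → pd (suc (2 * a) + 2 * r) ≡ not (pd (a + r))
pd-odd-+ a r = trans (cong (pd ∘ suc) (sym (*-distribˡ-+ 2 a r))) (pd-odd (a + r))

pd-mersenne-+-2^ : ∀ K → pd (mersenne K + 2 ^ K) ≡ not (pd (mersenne K))
pd-mersenne-+-2^ K = trans (cong pd (mersenne-+-2^ K)) (pd-odd (mersenne K))

pd-mersenne-even : ∀ e → pd (mersenne (2 * e)) ≡ false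
pd-mersenne-even zero    = refl
pd-mersenne-even (suc e) = begin
  pd (mersenne (2 * suc e))           ≡⟨ cong (pd ∘ mersenne) (*-suc 2 e) ⟩
  pd (mersenne (2 + 2 * e))           ≡⟨ pd-odd (mersenne (suc (2 * e))) ⟩
  not (pd (mersenne (suc (2 * e))))   ≡⟨ cong not (pd-odd (mersenne (2 * e))) ⟩
  not (not (pd (mersenne (2 * e))))   ≡⟨ not-involutive _ ⟩
  pd (mersenne (2 * e))               ≡⟨ pd-mersenne-even e ⟩
  false                               ∎
  where open ≡-Reasoning

pd-periodic : ∀ K a s → suc a < 2 ^ K → pd (a + s * 2 ^ K) ≡ pd a
pd-periodic zero    a s (s≤s ())
pd-periodic (suc K) a s a<2^K+1 with evenOdd a
... | even b = begin
  pd (2 * b + s * 2 ^ suc K)  ≡⟨ cong pd (regroup b s (2 ^ K)) ⟩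
  pd (2 * (b + s * 2 ^ K))    ≡⟨ pd-even (b + s * 2 ^ K) ⟩
  false                       ≡⟨ pd-even b ⟨
  pd (2 * b)                  ∎
  where
  open ≡-Reasoning
  regroup : ∀ b s P → 2 * b + s * (2 * P) ≡ 2 * (b + s * P)
  regroup = solve-∀
... | odd b = begin
  pd (suc (2 * b) + s * 2 ^ suc K)  ≡⟨ cong pd (regroup b s (2 ^ K)) ⟩
  pd (suc (2 * (b + s * 2 ^ K)))    ≡⟨ pd-odd (b + s * 2 ^ K) ⟩
  not (pd (b + s * 2 ^ K))          ≡⟨ cong not (pd-periodic K b s b<2^K) ⟩
  not (pd b)                        ≡⟨ pd-odd b ⟨
  pd (suc (2 * b))                  ∎
  where
  open ≡-Reasoning
  regroup : ∀ b s P → suc (2 * b) + s * (2 * P) ≡ suc (2 * (b + s * P))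
  regroup = solve-∀
  b<2^K : suc b < 2 ^ K
  b<2^K = *-cancelˡ-< 2 _ _ (subst (_< 2 ^ suc K) (sym (*-suc 2 b)) a<2^K+1)

pd-periodic-off-mersenne : ∀ K a s → suc a < 2 ^ suc K → a ≢ mersenne K →
                           pd (a + s * 2 ^ K) ≡ pd a
pd-periodic-off-mersenne K a s a<2^K+1 a≢M with <-cmp (suc a) (2 ^ K)
... | tri< a<2^K _ _   = pd-periodic K a s a<2^K
... | tri≈ _ 1+a≡2^K _ = contradiction (suc-injective (trans 1+a≡2^K (sym (suc-mersenne K)))) a≢M
... | tri> _ _ 2^K≤a   with m≤n⇒∃[o]m+o≡n (≤-pred 2^K≤a)
...   | d , refl = begin
  pd (2 ^ K + d + s * 2 ^ K)  ≡⟨ cong pd (regroup (2 ^ K) d s) ⟩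
  pd (d + suc s * 2 ^ K)      ≡⟨ pd-periodic K d (suc s) d<2^K ⟩
  pd d                        ≡⟨ pd-periodic K d 1 d<2^K ⟨
  pd (d + 1 * 2 ^ K)          ≡⟨ cong pd (regroup (2 ^ K) d 0) ⟨
  pd (2 ^ K + d + 0)          ≡⟨ cong pd (+-identityʳ (2 ^ K + d)) ⟩
  pd (2 ^ K + d)              ∎
  where
  open ≡-Reasoning
  regroup : ∀ P d s → P + d + s * P ≡ d + suc s * P
  regroup = solve-∀
  d<2^K : suc d < 2 ^ K
  d<2^K = +-cancelˡ-< (2 ^ K) _ _
            (subst₂ _<_ (sym (+-suc (2 ^ K) d)) (cong (2 ^ K +_) (+-identityʳ (2 ^ K))) a<2^K+1)

-- An odd start 2a + 1 halves to the start a one level down; an even start is refuted at offset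
-- 2 (M + 2), where pd is 0 after an even start but 1 after mersenne (suc j).
pd-rigid-at-mersenne : ∀ j q → (∀ r → 0 < r → r < 3 * 2 ^ j → pd (q + r) ≡ pd (mersenne j + r)) →
                       pd q ≡ pd (mersenne j)
pd-rigid-at-mersenne zero q agree with evenOdd q
... | even a = pd-even a
... | odd a  = contradiction (trans (sym (pd-even (suc a)))
                               (trans (cong pd (sym (regroup a))) (agree 1 z<s (s≤s (s≤s z≤n))))) λ ()
  where
  regroup : ∀ a → suc (2 * a) + 1 ≡ 2 * suc a
  regroup = solve-∀
pd-rigid-at-mersenne (suc j) q agree with evenOdd q
... | even a = contradiction (begin
  false                            ≡⟨ pd-even-+ a (2 + M) ⟨
  pd (2 * a + 2 * (2 + M))         ≡⟨ agree (2 * (2 + M)) z<s r<3·2^j+1 ⟩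
  pd (suc (2 * M) + 2 * (2 + M))   ≡⟨ pd-odd-+ M (2 + M) ⟩
  not (pd (M + (2 + M)))           ≡⟨ cong (not ∘ pd) (regroup M) ⟩
  not (pd (2 * suc M))             ≡⟨ cong not (pd-even (suc M)) ⟩
  true                             ∎) λ ()
  where
  open ≡-Reasoning
  M = mersenne j
  regroup : ∀ M → M + (2 + M) ≡ 2 * suc M
  regroup = solve-∀
  gap : ∀ M → 2 * (2 + M) + suc (suc (4 * M)) ≡ 3 * (2 * suc M)
  gap = solve-∀
  r<3·2^j+1 : 2 * (2 + M) < 3 * 2 ^ suc j
  r<3·2^j+1 = subst (λ P → 2 * (2 + M) < 3 * (2 * P)) (suc-mersenne j)
                    (subst (2 * (2 + M) <_) (gap M) (m<m+n _ z<s))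
... | odd a  = begin
  pd (suc (2 * a))     ≡⟨ pd-odd a ⟩
  not (pd a)           ≡⟨ cong not (pd-rigid-at-mersenne j a agree′) ⟩
  not (pd M)           ≡⟨ pd-odd M ⟨
  pd (suc (2 * M))     ∎
  where
  open ≡-Reasoning
  M = mersenne j
  regroup : ∀ P → 2 * (3 * P) ≡ 3 * (2 * P)
  regroup = solve-∀
  agree′ : ∀ r → 0 < r → r < 3 * 2 ^ j → pd (a + r) ≡ pd (M + r)
  agree′ r 0<r r<3·2^j = not-injective (begin
    not (pd (a + r))          ≡⟨ pd-odd-+ a r ⟨
    pd (suc (2 * a) + 2 * r)  ≡⟨ agree (2 * r) (*-monoʳ-< 2 0<r)
                                   (subst (2 * r <_) (regroup (2 ^ j)) (*-monoʳ-< 2 r<3·2^j)) ⟩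
    pd (suc (2 * M) + 2 * r)  ≡⟨ pd-odd-+ M r ⟩
    not (pd (M + r))          ∎)

PdPerturbation : (ℕ → Bool) → Set
PdPerturbation g = ∀ n → ¬ IsMersenne n → g n ≡ pd n

-- Of the two starts a and a + 2^K, one matches the value b wanted at mersenne K, since shifting
-- by 2^K toggles pd there and nowhere else below 2^(K+1) − 1.
pd-factor-near-mersenne :
  ∀ (g : ℕ → Bool) i a K m b → a + m < 2 ^ suc K →
  (∀ r → r < m → a + r ≢ mersenne K → g (i + r) ≡ pd (a + r)) →
  (∀ r → a + r ≡ mersenne K → g (i + r) ≡ b) →
  ∃ λ q → q ≤ a + 2 ^ K × SameFactor g i pd q m
pd-factor-near-mersenne g i a K m b a+m<2^K+1 off on with b Bool.≟ pd (mersenne K)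
... | yes b≡pdM = a , m≤m+n a _ , same
  where
  same : SameFactor g i pd a m
  same r r<m with a + r ≟ mersenne K
  ... | yes a+r≡M = trans (on r a+r≡M) (trans b≡pdM (cong pd (sym a+r≡M)))
  ... | no  a+r≢M = off r r<m a+r≢M
... | no b≢pdM = a + 2 ^ K , ≤-refl , same
  where
  open ≡-Reasoning
  same : SameFactor g i pd (a + 2 ^ K) m
  same r r<m with a + r ≟ mersenne K
  ... | yes a+r≡M = begin
    g (i + r)                ≡⟨ on r a+r≡M ⟩
    b                        ≡⟨ ¬-not b≢pdM ⟩
    not (pd (mersenne K))    ≡⟨ pd-mersenne-+-2^ K ⟨
    pd (mersenne K + 2 ^ K)  ≡⟨ cong (λ n → pd (n + 2 ^ K)) a+r≡M ⟨
    pd (a + r + 2 ^ K)       ≡⟨ cong pd (xy∙z≈xz∙y a r (2 ^ K)) ⟩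
    pd (a + 2 ^ K + r)       ∎
  ... | no  a+r≢M = begin
    g (i + r)                ≡⟨ off r r<m a+r≢M ⟩
    pd (a + r)               ≡⟨ pd-periodic-off-mersenne K (a + r) 1
                                  (≤-<-trans (+-monoʳ-< a r<m) a+m<2^K+1) a+r≢M ⟨
    pd (a + r + 1 * 2 ^ K)   ≡⟨ cong (λ n → pd (a + r + n)) (*-identityˡ (2 ^ K)) ⟩
    pd (a + r + 2 ^ K)       ≡⟨ cong pd (xy∙z≈xz∙y a r (2 ^ K)) ⟩
    pd (a + 2 ^ K + r)       ∎

pd-factor-occurs-early : ∀ K m → m ≤ 2 ^ K → ∀ i → ∃ λ q → q < 2 ^ suc K × SameFactor pd i pd q m
pd-factor-occurs-early K m m≤2^K i =
  map₂ (map₁ λ q≤a+2^K → ≤-<-trans q≤a+2^K (+-mono-<-≤ a<2^K (m≤m+n _ 0)))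
       (pd-factor-near-mersenne pd i a K m _ a+m<2^K+1 off on)
  where
  instance _ = m^n≢0 2 K
  a = i % 2 ^ K
  s = i / 2 ^ K
  a<2^K : a < 2 ^ K
  a<2^K = m%n<n i (2 ^ K)
  a+m<2^K+1 : a + m < 2 ^ suc K
  a+m<2^K+1 = +-mono-<-≤ a<2^K (≤-trans m≤2^K (m≤m+n _ 0))
  i+r≡ : ∀ r → i + r ≡ a + r + s * 2 ^ K
  i+r≡ r = trans (cong (_+ r) (m≡m%n+[m/n]*n i (2 ^ K))) (xy∙z≈xz∙y a (s * 2 ^ K) r)
  off : ∀ r → r < m → a + r ≢ mersenne K → pd (i + r) ≡ pd (a + r)
  off r r<m a+r≢M = trans (cong pd (i+r≡ r))
    (pd-periodic-off-mersenne K (a + r) s (≤-<-trans (+-monoʳ-< a r<m) a+m<2^K+1) a+r≢M)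
  on : ∀ r → a + r ≡ mersenne K → pd (i + r) ≡ pd (mersenne K + s * 2 ^ K)
  on r a+r≡M = cong pd (trans (i+r≡ r) (cong (_+ s * 2 ^ K) a+r≡M))

-- The only Mersenne number in [i, i + m) can be mersenne K: the smaller ones lie below i and the
-- next one exceeds 2 i.
pdPerturbation-late-factor-is-pd-factor : ∀ g → PdPerturbation g →
                                        ∀ i m → m ≤ i → ∃ λ q → SameFactor g i pd q m
pdPerturbation-late-factor-is-pd-factor g g≈pd i m m≤i with mersenne-above i
... | K , i≤M , below =
  map₂ proj₂ (pd-factor-near-mersenne g i i K m (g (mersenne K)) i+m<2^K+1 off (λ _ → cong g))
  where
  i+m≤2M : i + m ≤ 2 * mersenne K
  i+m≤2M = ≤-trans (+-monoʳ-≤ i (≤-trans m≤i (m≤m+n i 0))) (*-monoʳ-≤ 2 i≤M)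
  i+m<2^K+1 : i + m < 2 ^ suc K
  i+m<2^K+1 = ≤-<-trans i+m≤2M (subst (2 * mersenne K <_) (suc-mersenne (suc K)) (m<n⇒m<1+n (n<1+n _)))
  off : ∀ r → r < m → i + r ≢ mersenne K → g (i + r) ≡ pd (i + r)
  off r r<m i+r≢M = g≈pd (i + r) not-mersenne
    where
    not-mersenne : ¬ IsMersenne (i + r)
    not-mersenne (j , Mj≡i+r) with <-cmp j K
    ... | tri< j<K _ _  = <⇒≱ (below j j<K) (≤-trans (m≤m+n i r) (≤-reflexive (sym Mj≡i+r)))
    ... | tri≈ _ refl _ = i+r≢M (sym Mj≡i+r)
    ... | tri> _ _ K<j  = <⇒≱ (<-≤-trans (+-monoʳ-< i r<m) (≤-trans i+m≤2M (n≤1+n _)))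
                              (≤-trans (mersenne-mono-≤ K<j) (≤-reflexive Mj≡i+r))

early-pd-factor-recurs : ∀ g → PdPerturbation g → ∀ K q m → q + m < 2 ^ K → ∀ i →
                        ∃ λ j → i ≤ j × j + m ≤ i + 2 ^ suc K × SameFactor g j pd q m
early-pd-factor-recurs g g≈pd K q m q+m<2^K i = q + s * P , i≤j , j+m≤ , same
  where
  instance _ = m^n≢0 2 K
  P = 2 ^ K
  s = suc (i / P)
  i≤j : i ≤ q + s * P
  i≤j = ≤-trans (<⇒≤ (begin-strict
    i                   ≡⟨ m≡m%n+[m/n]*n i P ⟩
    i % P + i / P * P   <⟨ +-monoˡ-< (i / P * P) (m%n<n i P) ⟩
    s * P               ∎)) (m≤n+m _ q)
    where open ≤-Reasoning
  j+m≤ : q + s * P + m ≤ i + 2 ^ suc K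
  j+m≤ = begin
    q + s * P + m       ≡⟨ xy∙z≈xz∙y q (s * P) m ⟩
    q + m + s * P       ≤⟨ +-mono-≤ (<⇒≤ q+m<2^K) (+-monoʳ-≤ P (m/n*n≤m i P)) ⟩
    P + (P + i)         ≡⟨ regroup P i ⟩
    i + 2 ^ suc K       ∎
    where
    open ≤-Reasoning
    regroup : ∀ P i → P + (P + i) ≡ i + 2 * P
    regroup = solve-∀
  same : SameFactor g (q + s * P) pd q m
  same r r<m = begin
    g (q + s * P + r)   ≡⟨ cong g (xy∙z≈xz∙y q (s * P) r) ⟩
    g (q + r + s * P)   ≡⟨ g≈pd _ (a+[1+s]*2^K-notMersenne K (q + r) (i / P) q+r<P) ⟩
    pd (q + r + s * P)  ≡⟨ pd-periodic K (q + r) s q+r<P ⟩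
    pd (q + r)          ∎
    where
    open ≡-Reasoning
    q+r<P : suc (q + r) < P
    q+r<P = ≤-<-trans (+-monoʳ-< q r<m) q+m<2^K

module _ {k : ℕ} where

  toFin : Bool → Fin (2 + k)
  toFin false = zero
  toFin true  = suc zero

  toFin-injective : ∀ {a b} → toFin a ≡ toFin b → a ≡ b
  toFin-injective {false} {false} _ = refl
  toFin-injective {true}  {true}  _ = refl

  encode : (ℕ → Bool) → Seq (2 + k)
  encode g n = toFin (g n)

  occursAt-transfer : ∀ g h {x i j} →
                      OccursAt (encode h) x i → SameFactor g j h i (length x) → OccursAt (encode g) x j
  occursAt-transfer _ _ occ same r = trans (cong toFin (same (toℕ r) (toℕ<n r))) (occ r)

regulator : ℕ → ℕ
regulator m = 2 ^ (3 + m)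

pdPerturbation-lateFactorsRecur : ∀ {k} g → PdPerturbation g → LateFactorsRecur (encode {k} g) regulator
pdPerturbation-lateFactorsRecur g g≈pd x i R≤i occ i′ =
  let q₁ , g≡pd₁              = pdPerturbation-late-factor-is-pd-factor g g≈pd i m m≤i
      q , q<2^m+1 , pd₁≡pd    = pd-factor-occurs-early m m (<⇒≤ (n<2^n m)) q₁
      j , i′≤j , j+m≤ , gⱼ≡pd = early-pd-factor-recurs g g≈pd (2 + m) q m (q+m<2^m+2 q<2^m+1) i′
  in  j , i′≤j , j+m≤ , occursAt-transfer g g {x} {i} {j} occ λ r r<m →
                          trans (gⱼ≡pd r r<m) (sym (trans (g≡pd₁ r r<m) (pd₁≡pd r r<m)))
  where
  m = length x
  m≤2^m+1 : m ≤ 2 ^ suc m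
  m≤2^m+1 = ≤-trans (<⇒≤ (n<2^n m)) (^-monoʳ-≤ 2 (n≤1+n m))
  m≤i : m ≤ i
  m≤i = ≤-trans m≤2^m+1 (≤-trans (^-monoʳ-≤ 2 (s≤s (m≤n+m m 2))) R≤i)
  q+m<2^m+2 : ∀ {q} → q < 2 ^ suc m → q + m < 2 ^ (2 + m)
  q+m<2^m+2 q<2^m+1 = +-mono-<-≤ q<2^m+1 (≤-trans m≤2^m+1 (m≤m+n _ 0))

pdPerturbation-isRegulator : ∀ {k} g → PdPerturbation g → IsRegulator (encode {k} g) regulator
pdPerturbation-isRegulator g g≈pd =
  lateFactorsRecur⇒isRegulator {ω = encode g} (pdPerturbation-lateFactorsRecur g g≈pd)

pd-stronglyAlmostPeriodic : ∀ {k} → StronglyAlmostPeriodic (encode {k} pd)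
pd-stronglyAlmostPeriodic x _ (i , occ) = 2 ^ suc K , λ i′ →
  let j , i′≤j , j+m≤ , same = early-pd-factor-recurs pd (λ _ _ → refl) K i (length x) (n<2^n K) i′
  in  j , i′≤j , j+m≤ , occursAt-transfer pd pd {x} {i} {j} occ same
  where K = i + length x

-- The perturbed sequences

perturbed : ℕ → ℕ → Bool
perturbed J n = does (J ≤? n ×-dec isMersenne? n) ∨ pd n

perturbed-unmarked : ∀ J n → ¬ (J ≤ n × IsMersenne n) → perturbed J n ≡ pd n
perturbed-unmarked J n unmarked = cong (_∨ pd n) (dec-false (J ≤? n ×-dec isMersenne? n) unmarked)

perturbed-marked : ∀ J n → J ≤ n → IsMersenne n → perturbed J n ≡ true
perturbed-marked J n J≤n M = cong (_∨ pd n) (dec-true (J ≤? n ×-dec isMersenne? n) (J≤n , M))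

perturbed-where-pd-true : ∀ J n → pd n ≡ true → perturbed J n ≡ pd n
perturbed-where-pd-true J n pdn≡true =
  trans (cong (does (J ≤? n ×-dec isMersenne? n) ∨_) pdn≡true) (trans (∨-zeroʳ _) (sym pdn≡true))

perturbed-below : ∀ J n → n < J → perturbed J n ≡ pd n
perturbed-below J n n<J = perturbed-unmarked J n λ (J≤n , _) → <⇒≱ n<J J≤n

perturbed-pdPerturbation : ∀ J → PdPerturbation (perturbed J)
perturbed-pdPerturbation J n ¬M = perturbed-unmarked J n (¬M ∘ proj₂)

perturbed-near-mersenne : ∀ J j r → pd (mersenne j) ≡ false → 0 < r → r < 3 * 2 ^ j →
                          perturbed J (mersenne j + r) ≡ pd (mersenne j + r)
perturbed-near-mersenne J j r pdM≡false 0<r r<3·2^j with isMersenne? (mersenne j + r)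
... | no ¬M = perturbed-pdPerturbation J _ ¬M
... | yes (j′ , Mj′≡) = perturbed-where-pd-true J _ (begin
  pd (mersenne j + r)     ≡⟨ cong pd Mj′≡ ⟨
  pd (mersenne j′)        ≡⟨ cong (pd ∘ mersenne) j′≡j+1 ⟩
  pd (mersenne (suc j))   ≡⟨ pd-odd (mersenne j) ⟩
  not (pd (mersenne j))   ≡⟨ cong not pdM≡false ⟩
  true                    ∎)
  where
  open ≡-Reasoning
  regroup : ∀ M → M + 3 * suc M ≡ suc (2 * suc (2 * M))
  regroup = solve-∀
  M+3·2^j≡ : mersenne j + 3 * 2 ^ j ≡ mersenne (2 + j)
  M+3·2^j≡ = subst (λ P → mersenne j + 3 * P ≡ mersenne (2 + j)) (suc-mersenne j) (regroup (mersenne j))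
  j<j′ : j < j′
  j<j′ = mersenne-cancel-< (subst (mersenne j <_) (sym Mj′≡) (m<m+n _ 0<r))
  j′<j+2 : j′ < 2 + j
  j′<j+2 = mersenne-cancel-< (subst₂ _<_ (sym Mj′≡) M+3·2^j≡ (+-monoʳ-< (mersenne j) r<3·2^j))
  j′≡j+1 : j′ ≡ suc j
  j′≡j+1 = ≤-antisym (≤-pred j′<j+2) j<j′

perturbed-mersenne-factor-not-late :
  ∀ J j i → pd (mersenne j) ≡ false → J ≤ mersenne j → 3 * 2 ^ j ≤ i →
  ¬ SameFactor (perturbed J) i (perturbed J) (mersenne j) (3 * 2 ^ j)
perturbed-mersenne-factor-not-late J j i pdM≡false J≤M len≤i same
  with pdPerturbation-late-factor-is-pd-factor (perturbed J) (perturbed-pdPerturbation J)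
                                               i (3 * 2 ^ j) len≤i
... | q , window = contradiction (begin
  true                  ≡⟨ perturbed-marked J M J≤M (j , refl) ⟨
  perturbed J M         ≡⟨ cong (perturbed J) (+-identityʳ M) ⟨
  perturbed J (M + 0)   ≡⟨ same 0 0<len ⟨
  perturbed J (i + 0)   ≡⟨ window 0 0<len ⟩
  pd (q + 0)            ≡⟨ cong pd (+-identityʳ q) ⟩
  pd q                  ≡⟨ pd-rigid-at-mersenne j q agree ⟩
  pd M                  ≡⟨ pdM≡false ⟩
  false                 ∎) λ ()
  where
  open ≡-Reasoning
  M = mersenne j
  0<len : 0 < 3 * 2 ^ j
  0<len = ≤-trans (m^n>0 2 j) (m≤m+n _ _)
  agree : ∀ r → 0 < r → r < 3 * 2 ^ j → pd (q + r) ≡ pd (M + r)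
  agree r 0<r r<len = begin
    pd (q + r)            ≡⟨ window r r<len ⟨
    perturbed J (i + r)   ≡⟨ same r r<len ⟩
    perturbed J (M + r)   ≡⟨ perturbed-near-mersenne J j r pdM≡false 0<r r<len ⟩
    pd (M + r)            ∎

perturbed-not-eventuallyStronglyAlmostPeriodic :
  ∀ {k} J → ¬ EventuallyStronglyAlmostPeriodic (encode {k} (perturbed J))
perturbed-not-eventuallyStronglyAlmostPeriodic {k} J (n , sap) =
  let _ , every            = sap x 1≤|x| (M ∸ n , occ₀)
      i , len≤i , _ , occᵢ = every len
  in  perturbed-mersenne-factor-not-late J j (n + i) (pd-mersenne-even (n + J)) J≤M
        (≤-trans len≤i (m≤n+m i n)) (same occᵢ)
  where
  j = 2 * (n + J)
  M = mersenne j
  len = 3 * 2 ^ j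
  ω′ = suffix (encode {k} (perturbed J)) n
  x = factor ω′ (M ∸ n) len
  occ₀ = factor-occursAt ω′ (M ∸ n) len
  n+J≤M : n + J ≤ M
  n+J≤M = ≤-trans (m≤m+n (n + J) _) (j≤mersenne j)
  J≤M : J ≤ M
  J≤M = ≤-trans (m≤n+m J n) n+J≤M
  1≤|x| : 1 ≤ length x
  1≤|x| = subst (1 ≤_) (sym (length-factor ω′ (M ∸ n) len)) (≤-trans (m^n>0 2 j) (m≤m+n _ _))
  same : ∀ {i} → OccursAt ω′ x i → SameFactor (perturbed J) (n + i) (perturbed J) M len
  same {i} occᵢ r r<len = toFin-injective (begin
    encode (perturbed J) (n + i + r)        ≡⟨ cong (encode (perturbed J)) (+-assoc n i r) ⟩
    ω′ (i + r)                              ≡⟨ occursAt-sameFactor {ω = ω′} {x} occᵢ occ₀ r r<|x| ⟩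
    ω′ (M ∸ n + r)                          ≡⟨ cong (encode (perturbed J)) (+-assoc n (M ∸ n) r) ⟨
    encode (perturbed J) (n + (M ∸ n) + r)  ≡⟨ cong (λ m → encode (perturbed J) (m + r))
                                                  (m+[n∸m]≡n (≤-trans (m≤m+n n J) n+J≤M)) ⟩
    encode (perturbed J) (M + r)            ∎)
    where
    open ≡-Reasoning
    r<|x| : r < length x
    r<|x| = subst (r <_) (sym (length-factor ω′ (M ∸ n) len)) r<len

theorem7 : (k : ℕ) → 2 ≤ k →
    ¬ (Σ (OracleAlg k) λ A →
         (ω : Seq k) (f : ℕ → ℕ) → AlmostPeriodic ω → IsRegulator ω f →
         DecidesESAP A ω f)
theorem7 (suc (suc k)) (s≤s (s≤s z≤n)) (A , decides) =
  let _ , halts , pd-answer       = decides-on pd (λ _ _ → refl)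
      N , continuity              = haltsWith-continuous A regulator halts
      J                           = suc N
      _ , halts′ , perturbed-answer = decides-on (perturbed J) (perturbed-pdPerturbation J)
      same-answer = haltsWith-functional A regulator
                      (continuity _ λ i i≤N → cong toFin (perturbed-below J i (s≤s i≤N))) halts′
      pd-yes      = Equivalence.from pd-answer (0 , pd-stronglyAlmostPeriodic)
  in  perturbed-not-eventuallyStronglyAlmostPeriodic J
        (Equivalence.to perturbed-answer (trans (sym same-answer) pd-yes))
  where
  decides-on : ∀ g → PdPerturbation g → DecidesESAP A (encode g) regulator
  decides-on g g≈pd =
    decides (encode g) regulator (isRegulator⇒almostPeriodic {ω = encode g} regulates) regulates
    where regulates = pdPerturbation-isRegulator g g≈pd
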